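{- Let $n\ge 2$ and let $d_1,\dots,d_n$ be positive integers with $d_n\ge d_1\ge 1$. Let $(d_j)_{j\ge1}$ be the sequence extended periodically by $d_{i}=d_{i+n-1}$ for all $i\ge 2$ (so that $\alpha=[0;1+d_1,\overline{d_2,\ldots,d_n}]$). Define words over $\{a,b\}$ by $s_{ -1}=b$, $s_0=a$, $s_j=s_{j-1}^{d_j}s_{j-2}$ for $j\ge1$, and let $\sigma$ be the morphism of $\{a,b\}^*$ given by $\sigma(a)=s_{n-1}$, $\sigma(b)=s_{n-1}^{d_n-d_1}s_{n-2}$. Then for every integer $k\ge 0$, $\sigma(s_k)=s_{k+(n-1)}$. Consequently, for every fixed $k\ge0$ and every $m\ge0$, $\sigma^m(s_k)=s_{k+m(n-1)}$.
   Context: Words are finite sequences over the alphabet $\{a,b\}$ with concatenation; a morphism is a map $\psi$ on words with $\psi(uv)=\psi(u)\psi(v)$, determined by its values on letters. $\sigma^0$ denotes the identity morphism. -}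

module Defs where

open import Data.Nat using (ℕ; zero; suc; _+_; _∸_)
open import Data.List using (List; []; _∷_; _++_; concatMap)
open import Data.Product using (_×_; _,_; proj₁; proj₂)

data Letter : Set where
  a b : Letter

Word : Set
Word = List Letter

_^ʷ_ : Word → ℕ → Word
u ^ʷ zero  = []
u ^ʷ suc k = u ++ (u ^ʷ k)

morph : Word → Word → Word → Word
morph ψa ψb = concatMap (λ { a → ψa ; b → ψb })

iter : {A : Set} → ℕ → (A → A) → A → A
iter zero    f x = x
iter (suc m) f x = f (iter m f x)

-- Given d : ℕ → ℕ (d j = d_j for j ≥ 1; d 0 unused),
-- sPair d j = (s_j , s_{j-1}), with s_{-1} = b, s_0 = a,
-- s_j = s_{j-1}^{d_j} s_{j-2}.
sPair : (ℕ → ℕ) → ℕ → Word × Word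
sPair d zero = (a ∷ [] , b ∷ [])
sPair d (suc j) with sPair d j
... | (u , v) = ((u ^ʷ d (suc j)) ++ v , u)

s : (ℕ → ℕ) → ℕ → Word
s d k = proj₁ (sPair d k)

σ : (ℕ → ℕ) → ℕ → Word → Word
σ d n = morph (s d (n ∸ 1)) ((s d (n ∸ 1) ^ʷ (d n ∸ d 1)) ++ s d (n ∸ 2))

-- The words s_k satisfy s_{k+2} = s_{k+1}^{d_{k+2}} s_k, so any morphism that maps the two
-- seeds s_0, s_1 to s_p, s_{1+p} maps every s_k to s_{k+p}, provided the exponents are
-- p-periodic from index 2 on. For σ and p = n - 1 the seed equations hold: σ(s_0) = s_{n-1}
-- by definition, and σ(s_1) = s_{n-1}^{d_1} s_{n-1}^{d_n - d_1} s_{n-2} = s_n because d_1 ≤ d_n.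
module Submission where

open import Defs
open import Data.Nat using (ℕ; zero; suc; _+_; _*_; _∸_; _≤_; s≤s; z≤n)
open import Data.Nat.Properties using (m+[n∸m]≡n; +-assoc; +-comm; +-identityʳ)
open import Data.List using ([]; _∷_; _++_)
open import Data.List.Properties using (++-assoc; ++-identityʳ)
open import Data.Product using (_×_; _,_)
open import Relation.Binary.PropositionalEquality using (_≡_; refl; sym; trans; cong; cong₂; module ≡-Reasoning)

^ʷ-+ : ∀ (u : Word) i j → (u ^ʷ i) ++ (u ^ʷ j) ≡ u ^ʷ (i + j)
^ʷ-+ u zero    j = refl
^ʷ-+ u (suc i) j = trans (++-assoc u _ _) (cong (u ++_) (^ʷ-+ u i j))

morph-++ : ∀ A B u v → morph A B (u ++ v) ≡ morph A B u ++ morph A B v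
morph-++ A B []      v = refl
morph-++ A B (a ∷ u) v = trans (cong (A ++_) (morph-++ A B u v)) (sym (++-assoc A _ _))
morph-++ A B (b ∷ u) v = trans (cong (B ++_) (morph-++ A B u v)) (sym (++-assoc B _ _))

morph-^ʷ : ∀ A B u k → morph A B (u ^ʷ k) ≡ morph A B u ^ʷ k
morph-^ʷ A B u zero    = refl
morph-^ʷ A B u (suc k) = trans (morph-++ A B u (u ^ʷ k)) (cong (morph A B u ++_) (morph-^ʷ A B u k))

morph-s-shift : ∀ A B d p
  → (∀ i → 2 ≤ i → d i ≡ d (i + p))
  → morph A B (s d 0) ≡ s d p
  → morph A B (s d 1) ≡ s d (1 + p)
  → ∀ k → morph A B (s d k) ≡ s d (k + p)
morph-s-shift A B d p per seed₀ seed₁ = shift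
  where
  shift : ∀ k → morph A B (s d k) ≡ s d (k + p)
  shift zero          = seed₀
  shift (suc zero)    = seed₁
  shift (suc (suc k)) = begin
      morph A B ((s d (suc k) ^ʷ e) ++ s d k)
    ≡⟨ morph-++ A B (s d (suc k) ^ʷ e) (s d k) ⟩
      morph A B (s d (suc k) ^ʷ e) ++ morph A B (s d k)
    ≡⟨ cong₂ _++_ (morph-^ʷ A B (s d (suc k)) e) (shift k) ⟩
      (morph A B (s d (suc k)) ^ʷ e) ++ s d (k + p)
    ≡⟨ cong (λ w → (w ^ʷ e) ++ s d (k + p)) (shift (suc k)) ⟩
      (s d (suc k + p) ^ʷ e) ++ s d (k + p)
    ≡⟨ cong (λ e′ → (s d (suc k + p) ^ʷ e′) ++ s d (k + p)) (per (suc (suc k)) (s≤s (s≤s z≤n))) ⟩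
      s d (suc (suc k) + p)
    ∎
    where
    open ≡-Reasoning
    e = d (suc (suc k))

iter-shift : ∀ {A : Set} (f : A → A) (g : ℕ → A) p
  → (∀ k → f (g k) ≡ g (k + p))
  → ∀ k m → iter m f (g k) ≡ g (k + m * p)
iter-shift f g p step k zero    = cong g (sym (+-identityʳ k))
iter-shift f g p step k (suc m) = begin
    f (iter m f (g k))  ≡⟨ cong f (iter-shift f g p step k m) ⟩
    f (g (k + m * p))   ≡⟨ step (k + m * p) ⟩
    g (k + m * p + p)   ≡⟨ cong g (+-assoc k (m * p) p) ⟩
    g (k + (m * p + p)) ≡⟨ cong (λ q → g (k + q)) (+-comm (m * p) p) ⟩
    g (k + suc m * p)   ∎
  where open ≡-Reasoning

module _ (m : ℕ) (d : ℕ → ℕ) where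
  private
    n = suc (suc m)
    A = s d (suc m)
    B = (A ^ʷ (d n ∸ d 1)) ++ s d m

  σ-s₀ : σ d n (s d 0) ≡ s d (suc m)
  σ-s₀ = ++-identityʳ A

  σ-s₁ : d 1 ≤ d n → σ d n (s d 1) ≡ s d n
  σ-s₁ d₁≤dₙ = begin
      morph A B (((a ∷ []) ^ʷ d 1) ++ b ∷ [])
    ≡⟨ morph-++ A B ((a ∷ []) ^ʷ d 1) (b ∷ []) ⟩
      morph A B ((a ∷ []) ^ʷ d 1) ++ (B ++ [])
    ≡⟨ cong₂ _++_ (morph-^ʷ A B (a ∷ []) (d 1)) (++-identityʳ B) ⟩
      ((A ++ []) ^ʷ d 1) ++ B
    ≡⟨ cong (λ w → (w ^ʷ d 1) ++ B) (++-identityʳ A) ⟩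
      (A ^ʷ d 1) ++ ((A ^ʷ (d n ∸ d 1)) ++ s d m)
    ≡⟨ sym (++-assoc (A ^ʷ d 1) _ _) ⟩
      ((A ^ʷ d 1) ++ (A ^ʷ (d n ∸ d 1))) ++ s d m
    ≡⟨ cong (_++ s d m) (^ʷ-+ A (d 1) (d n ∸ d 1)) ⟩
      (A ^ʷ (d 1 + (d n ∸ d 1))) ++ s d m
    ≡⟨ cong (λ e → (A ^ʷ e) ++ s d m) (m+[n∸m]≡n d₁≤dₙ) ⟩
      (A ^ʷ d n) ++ s d m
    ∎
    where open ≡-Reasoning

lemma3p2 : (n : ℕ) → 2 ≤ n → (d : ℕ → ℕ)
    → (∀ i → 1 ≤ i → i ≤ n → 1 ≤ d i)
    → d 1 ≤ d n
    → (∀ i → 2 ≤ i → d i ≡ d (i + (n ∸ 1)))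
    → (∀ k → σ d n (s d k) ≡ s d (k + (n ∸ 1)))
      × (∀ k m → iter m (σ d n) (s d k) ≡ s d (k + m * (n ∸ 1)))
lemma3p2 (suc (suc m)) (s≤s (s≤s z≤n)) d _ d₁≤dₙ per = σ-shift , iter-shift (σ d n) (s d) (suc m) σ-shift
  where
  n = suc (suc m)
  σ-shift : ∀ k → σ d n (s d k) ≡ s d (k + suc m)
  σ-shift = morph-s-shift _ _ d (suc m) per (σ-s₀ m d) (σ-s₁ m d d₁≤dₙ)
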